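{- Let $r,k\in\{0,1,\dots\}$ and let $\equiv$ denote $r$-equivalence on graphs of arity $k$. Then $\equiv$ is a congruence for $k$-fusion: for all graphs $G_1,G_2,G_1',G_2'$ of arity $k$, if $G_1\equiv G_1'$ and $G_2\equiv G_2'$, then $G_1\oplus G_2\equiv G_1'\oplus G_2'$.
   Context: Graphs are finite and undirected. A graph of arity $k$ is a graph with a tuple of $k$ pairwise distinct distinguished vertices (ports). The $k$-fusion $G_1\oplus G_2$ of two graphs of arity $k$ is the disjoint union in which, for each $i\le k$, the $i$-th ports of the two graphs are identified (edges are accumulated). Separator logic is first-order logic over the vertex set with the edge relation $E(x,y)$ and, for every $n\ge0$, the relation $S_n(x,y,z_1,\dots,z_n)$ saying that every path from $x$ to $y$ uses some vertex among $z_1,\dots,z_n$. A formula with free variables $x_1,\dots,x_k$ is evaluated on a graph of arity $k$ by interpreting $x_i$ as the $i$-th port. Two graphs are $r$-equivalent if they have the same arity $k$ and satisfy the same separator-logic formulas with free variables $x_1,\dots,x_k$ of quantifier rank at most $r$. -}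

module Defs where

open import Data.Nat using (ℕ; zero; suc; _≤_; _⊔_)
open import Data.Fin using (Fin)
open import Data.Fin.Properties using (any?)
open import Data.Bool using (Bool; true; false; T; not; _∨_)
open import Data.Empty using (⊥; ⊥-elim-irr)
open import Data.Irrelevant using (Irrelevant) renaming ([_] to irr)
open import Data.Unit using (tt)
open import Data.Maybe using (Maybe; just; nothing)
open import Data.Sum using (_⊎_; inj₁; inj₂)
import Data.Sum.Properties as SumP
import Data.Product.Properties as ProdP
open import Data.Product using (Σ; ∃; _×_; _,_)
open import Data.List using (List; []; _∷_; map; _++_)
open import Data.List.Membership.Propositional using (_∈_)
open import Data.List.Membership.Propositional.Properties using (∈-map⁺; ∈-++⁺ˡ; ∈-++⁺ʳ)
open import Data.List.Relation.Unary.Any using (Any)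
open import Data.List.Relation.Unary.Unique.Propositional using (Unique)
open import Data.Vec using (Vec; toList)
import Data.Vec as Vec
open import Data.Vec.Functional using () renaming (_∷_ to _▹_)
open import Function using (Injective; _∘_; _⇔_)
open import Relation.Nullary using (¬_; Dec; yes; no; does)
open import Relation.Nullary.Decidable using (False; fromWitnessFalse; toWitnessFalse)
open import Relation.Binary.Definitions using (DecidableEquality)
open import Relation.Binary.PropositionalEquality using (_≡_; refl; cong; subst)

record Graph (k : ℕ) : Set₁ where
  field
    V        : Set
    _≟_      : DecidableEquality V
    enum     : List V
    complete : ∀ v → v ∈ enum
    E        : V → V → Bool
    E-sym    : ∀ x y → E x y ≡ E y x
    E-irr    : ∀ x → E x x ≡ false
    port     : Fin k → V
    port-inj : Injective _≡_ _≡_ port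

-- k-fusion G₁ ⊕ G₂: vertices are those of G₁ together with the non-port
-- vertices of G₂; the i-th port of G₂ is identified with the i-th port of G₁.

module Fusion {k : ℕ} (G₁ G₂ : Graph k) where
  module A = Graph G₁
  module B = Graph G₂

  isPort₁? : (a : A.V) → Dec (∃ λ i → A.port i ≡ a)
  isPort₁? a = any? (λ i → A.port i A.≟ a)

  isPort₂? : (v : B.V) → Dec (∃ λ i → B.port i ≡ v)
  isPort₂? v = any? (λ i → B.port i B.≟ v)

  NonPort : B.V → Set
  NonPort v = Irrelevant (False (isPort₂? v))

  W : Set
  W = A.V ⊎ Σ B.V NonPort

  ι₁ : A.V → W
  ι₁ = inj₁

  ι₂-aux : (v : B.V) → Dec (∃ λ i → B.port i ≡ v) → W
  ι₂-aux v (yes (i , _)) = inj₁ (A.port i)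
  ι₂-aux v (no ¬p)       = inj₂ (v , irr (fromWitnessFalse ¬p))

  ι₂ : B.V → W
  ι₂ v = ι₂-aux v (isPort₂? v)

  back₁ : W → Maybe A.V
  back₁ (inj₁ a) = just a
  back₁ (inj₂ _) = nothing

  back₂-aux : (a : A.V) → Dec (∃ λ i → A.port i ≡ a) → Maybe B.V
  back₂-aux a (yes (i , _)) = just (B.port i)
  back₂-aux a (no _)        = nothing

  back₂ : W → Maybe B.V
  back₂ (inj₁ a)       = back₂-aux a (isPort₁? a)
  back₂ (inj₂ (v , _)) = just v

  both : {X : Set} → (X → X → Bool) → Maybe X → Maybe X → Bool
  both f (just x) (just y) = f x y
  both f _        _        = false

  both-sym : {X : Set} (f : X → X → Bool) → (∀ x y → f x y ≡ f y x) →
             ∀ x y → both f x y ≡ both f y x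
  both-sym f s (just x) (just y) = s x y
  both-sym f s (just x) nothing  = refl
  both-sym f s nothing  (just y) = refl
  both-sym f s nothing  nothing  = refl

  both-irr : {X : Set} (f : X → X → Bool) → (∀ x → f x x ≡ false) →
             ∀ x → both f x x ≡ false
  both-irr f i (just x) = i x
  both-irr f i nothing  = refl

  EW : W → W → Bool
  EW x y = both A.E (back₁ x) (back₁ y) ∨ both B.E (back₂ x) (back₂ y)

  EW-sym : ∀ x y → EW x y ≡ EW y x
  EW-sym x y rewrite both-sym A.E A.E-sym (back₁ x) (back₁ y)
                   | both-sym B.E B.E-sym (back₂ x) (back₂ y) = refl

  EW-irr : ∀ x → EW x x ≡ false
  EW-irr x rewrite both-irr A.E A.E-irr (back₁ x)
                 | both-irr B.E B.E-irr (back₂ x) = refl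

  decNP : ∀ {v} → DecidableEquality (NonPort v)
  decNP _ _ = yes refl

  _≟W_ : DecidableEquality W
  _≟W_ = SumP.≡-dec A._≟_ (ProdP.≡-dec B._≟_ decNP)

  enumW : List W
  enumW = map ι₁ A.enum ++ map ι₂ B.enum

  ι₂-hit : ∀ v (t : NonPort v) → ι₂ v ≡ inj₂ (v , t)
  ι₂-hit v t@(irr f₀) = aux (isPort₂? v) f₀
    where
    aux : (d : Dec (∃ λ i → B.port i ≡ v)) → .(False d) → ι₂-aux v d ≡ inj₂ (v , t)
    aux (yes p) f = ⊥-elim-irr (toWitnessFalse {a? = yes p} f p)
    aux (no _)  f = refl

  completeW : ∀ w → w ∈ enumW
  completeW (inj₁ a) = ∈-++⁺ˡ (∈-map⁺ ι₁ (A.complete a))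
  completeW (inj₂ (v , t)) =
    ∈-++⁺ʳ (map ι₁ A.enum) (subst (_∈ map ι₂ B.enum) (ι₂-hit v t) (∈-map⁺ ι₂ (B.complete v)))

  portW : Fin k → W
  portW i = inj₁ (A.port i)

  portW-inj : Injective _≡_ _≡_ portW
  portW-inj p = A.port-inj (SumP.inj₁-injective p)

  fused : Graph k
  fused = record
    { V = W ; _≟_ = _≟W_ ; enum = enumW ; complete = completeW
    ; E = EW ; E-sym = EW-sym ; E-irr = EW-irr
    ; port = portW ; port-inj = portW-inj }

_⊕_ : {k : ℕ} → Graph k → Graph k → Graph k
G₁ ⊕ G₂ = Fusion.fused G₁ G₂

-- Separator logic.  Formulas with n free variables (de Bruijn indices Fin n).
-- Atoms: equality, edge relation E, and S_m(x, y, z₁ … z_m) for every m.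

data Formula (n : ℕ) : Set where
  eq'   : Fin n → Fin n → Formula n
  edge' : Fin n → Fin n → Formula n
  sep'  : {m : ℕ} → Fin n → Fin n → Vec (Fin n) m → Formula n
  ¬'_   : Formula n → Formula n
  _∧'_  : Formula n → Formula n → Formula n
  ∃'_   : Formula (suc n) → Formula n

qr : {n : ℕ} → Formula n → ℕ
qr (eq' _ _)    = 0
qr (edge' _ _)  = 0
qr (sep' _ _ _) = 0
qr (¬' φ)       = qr φ
qr (φ ∧' ψ)     = qr φ ⊔ qr ψ
qr (∃' φ)       = suc (qr φ)

module _ {k : ℕ} (G : Graph k) where
  open Graph G

  data Walk : V → V → Set where
    [_]  : (x : V) → Walk x x
    step : {x y z : V} → T (E x y) → Walk y z → Walk x z

  vertices : {x y : V} → Walk x y → List V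
  vertices [ x ]              = x ∷ []
  vertices (step {x = x} _ w) = x ∷ vertices w

  IsPath : {x y : V} → Walk x y → Set
  IsPath w = Unique (vertices w)

  Separates : V → V → List V → Set
  Separates x y zs = (w : Walk x y) → IsPath w → Any (_∈ zs) (vertices w)

  Sat : {n : ℕ} → (Fin n → V) → Formula n → Set
  Sat ρ (eq' i j)     = ρ i ≡ ρ j
  Sat ρ (edge' i j)   = T (E (ρ i) (ρ j))
  Sat ρ (sep' i j zs) = Separates (ρ i) (ρ j) (toList (Vec.map ρ zs))
  Sat ρ (¬' φ)        = ¬ Sat ρ φ
  Sat ρ (φ ∧' ψ)      = Sat ρ φ × Sat ρ ψ
  Sat ρ (∃' φ)        = Σ V (λ v → Sat (v ▹ ρ) φ)

  _⊨_ : Formula k → Set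
  _⊨_ φ = Sat port φ

_≡[_]_ : {k : ℕ} → Graph k → ℕ → Graph k → Set
_≡[_]_ {k} G r H = (φ : Formula k) → qr φ ≤ r → (G ⊨ φ) ⇔ (H ⊨ φ)

-- An Ehrenfeucht–Fraïssé-style transfer.  A tuple of vertices of G₁ ⊕ G₂ is
-- described by places: ports, and anchors into a tuple of vertices of one side.
-- The invariant is that on each side the anchor tuple (which contains the ports)
-- is rank-r equivalent to the corresponding tuple of G₁′ ⊕ G₂′.  Equality and
-- adjacency in the fusion are witnessed on a single side, so they transfer.  A
-- walk of the fusion avoiding Z cuts at ports into walks of the sides avoiding
-- the side parts of Z, and each of these is the failure of a quantifier-free
-- separator atom of a side, so separation transfers too.  An ∃-witness is a port
-- or lies on one side, where back-and-forth for rank r + 1 provides a partner;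
-- constructively only under double negation, which is harmless because
-- satisfaction in finite graphs is decidable.
module Submission where

open import Defs
open import Data.Nat using (ℕ; zero; suc; _≤_; z≤n; s≤s)
open import Data.Nat.Properties using (≤-trans; n≤1+n; ⊔-lub; m⊔n≤o⇒m≤o; m⊔n≤o⇒n≤o)
open import Data.Fin using (Fin)
import Data.Fin as Fin
open import Data.Bool using (Bool; T)
open import Data.Bool.Properties using (T?; T-∨)
open import Data.Empty using (⊥; ⊥-elim; ⊥-elim-irr)
open import Data.Irrelevant using () renaming ([_] to irr)
open import Data.Maybe using (Maybe; just; nothing)
import Data.Maybe as Maybe
open import Data.Maybe.Properties using (just-injective; map-just)
open import Data.Sum using (_⊎_; inj₁; inj₂)
open import Data.Unit using (⊤; tt)
open import Data.Product using (Σ; ∃; ∃-syntax; _×_; _,_; proj₁; proj₂)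
open import Data.List using (List; []; _∷_; length; map; mapMaybe)
open import Data.List.Properties using (length-removeAt′; map-∘)
open import Data.List.Membership.Propositional using (_∈_; _∉_; find; lose)
open import Data.List.Relation.Unary.Any using (Any; here; there; _─_)
import Data.List.Relation.Unary.Any as Any
open import Data.List.Relation.Unary.All using (All; []; _∷_)
import Data.List.Relation.Unary.All as All
open import Data.List.Relation.Unary.All.Properties using (¬Any⇒All¬) renaming (map⁺ to All-map⁺)
open import Data.List.Relation.Unary.Unique.Propositional using (Unique; []; _∷_)
open import Data.Vec using (Vec; toList; fromList)
import Data.Vec as Vec
open import Data.Vec.Properties using (map-cong; toList-map; toList∘fromList)
open import Data.Vec.Functional using () renaming (_∷_ to _▹_)
open import Function using (_∘_; _⇔_; mk⇔; Equivalence)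
open import Relation.Nullary using (¬_; Dec; yes; no; ¬?)
open import Relation.Nullary.Decidable using (_×-dec_; decidable-stable; False)
open import Relation.Binary.Definitions using (DecidableEquality)
open import Relation.Binary.PropositionalEquality using (_≡_; _≢_; refl; sym; trans; cong; subst; subst₂)

open Equivalence using (to; from)

∈-─ : ∀ {A : Set} {x z : A} {ys} (x∈ys : x ∈ ys) → z ∈ ys → x ≢ z → z ∈ (ys ─ x∈ys)
∈-─ (here refl)  (here refl)  x≢z = ⊥-elim (x≢z refl)
∈-─ (here _)     (there z∈ys) _   = z∈ys
∈-─ (there _)    (here refl)  _   = here refl
∈-─ (there x∈ys) (there z∈ys) x≢z = there (∈-─ x∈ys z∈ys x≢z)

unique-length≤ : ∀ {A : Set} {xs ys : List A} → Unique xs →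
                 (∀ {x} → x ∈ xs → x ∈ ys) → length xs ≤ length ys
unique-length≤ {xs = []} [] _ = z≤n
unique-length≤ {xs = x ∷ xs} {ys} (x∉xs ∷ uxs) xs⊆ys =
  subst (suc (length xs) ≤_) (sym (length-removeAt′ ys _))
    (s≤s (unique-length≤ uxs λ z∈xs →
      ∈-─ (xs⊆ys (here refl)) (xs⊆ys (there z∈xs)) (All.lookup x∉xs z∈xs)))

module _ {A B : Set} (f : A → Maybe B) where
  ∈-mapMaybe⁺ : ∀ {x y xs} → x ∈ xs → f x ≡ just y → y ∈ mapMaybe f xs
  ∈-mapMaybe⁺ (here refl) fx≡y rewrite fx≡y = here refl
  ∈-mapMaybe⁺ {xs = x ∷ _} (there x∈) fx≡y with f x
  ... | just _  = there (∈-mapMaybe⁺ x∈ fx≡y)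
  ... | nothing = ∈-mapMaybe⁺ x∈ fx≡y

  ∈-mapMaybe⁻ : ∀ {y} xs → y ∈ mapMaybe f xs → ∃ λ x → x ∈ xs × f x ≡ just y
  ∈-mapMaybe⁻ (x ∷ xs) y∈ with f x in fx≡
  ∈-mapMaybe⁻ (x ∷ xs) (here refl) | just _ = x , here refl , fx≡
  ∈-mapMaybe⁻ (x ∷ xs) (there y∈)  | just _ = let z , z∈ , e = ∈-mapMaybe⁻ xs y∈ in z , there z∈ , e
  ∈-mapMaybe⁻ (x ∷ xs) y∈          | nothing = let z , z∈ , e = ∈-mapMaybe⁻ xs y∈ in z , there z∈ , e

mapMaybe-map : ∀ {A B C D : Set} {f : B → Maybe C} {g : A → B} {h : D → C} {i : A → Maybe D} {xs} →
               All (λ x → f (g x) ≡ Maybe.map h (i x)) xs → mapMaybe f (map g xs) ≡ map h (mapMaybe i xs)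
mapMaybe-map [] = refl
mapMaybe-map {f = f} {g} {i = i} {x ∷ _} (e ∷ es) with f (g x) | i x | e
... | _ | just _  | refl = cong (_ ∷_) (mapMaybe-map es)
... | _ | nothing | refl = mapMaybe-map es

map-just⁻ : ∀ {A B : Set} {f : A → B} m {b} → Maybe.map f m ≡ just b → ∃ λ a → m ≡ just a × f a ≡ b
map-just⁻ (just a) refl = a , refl , refl

toList-map∘fromList : ∀ {A B : Set} (f : A → B) xs → toList (Vec.map f (fromList xs)) ≡ map f xs
toList-map∘fromList f xs = trans (toList-map f (fromList xs)) (cong (map f) (toList∘fromList xs))

-- Connectivity avoiding a set, and decidability of satisfaction

module Connectivity {k : ℕ} (G : Graph k) where
  open Graph G

  Avoids : List V → {x y : V} → Walk G x y → Set
  Avoids Z w = All (_∉ Z) (vertices G w)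

  Connected : V → V → List V → Set
  Connected x y Z = Σ (Walk G x y) (Avoids Z)

  _++ʷ_ : ∀ {x y z} → Walk G x y → Walk G y z → Walk G x z
  [ _ ]    ++ʷ w′ = w′
  step e w ++ʷ w′ = step e (w ++ʷ w′)

  avoids-++ʷ : ∀ {x y z Z} (w : Walk G x y) {w′ : Walk G y z} →
               Avoids Z w → Avoids Z w′ → Avoids Z (w ++ʷ w′)
  avoids-++ʷ [ _ ]      _          a′ = a′
  avoids-++ʷ (step _ w) (x∉Z ∷ a) a′ = x∉Z ∷ avoids-++ʷ w a a′

  start-avoids : ∀ {x y Z} (w : Walk G x y) → Avoids Z w → x ∉ Z
  start-avoids [ _ ]      (x∉Z ∷ _) = x∉Z
  start-avoids (step _ _) (x∉Z ∷ _) = x∉Z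

  connected-trans : ∀ {x y z Z} → Connected x y Z → Connected y z Z → Connected x z Z
  connected-trans (w , a) (w′ , a′) = w ++ʷ w′ , avoids-++ʷ w a a′

  _⊆ᵛ_ : ∀ {x y x′ y′} → Walk G x y → Walk G x′ y′ → Set
  w ⊆ᵛ w′ = ∀ {v} → v ∈ vertices G w → v ∈ vertices G w′

  suffix : ∀ {x y u} (w : Walk G x y) → u ∈ vertices G w →
           Σ (Walk G u y) λ w′ → w′ ⊆ᵛ w × (IsPath G w → IsPath G w′)
  suffix [ _ ]      (here refl)  = [ _ ] , (λ v∈ → v∈) , (λ p → p)
  suffix (step e w) (here refl)  = step e w , (λ v∈ → v∈) , (λ p → p)
  suffix (step e w) (there u∈w) with suffix w u∈w
  ... | w′ , w′⊆w , path = w′ , there ∘ w′⊆w , λ { (_ ∷ p) → path p }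

  walk⇒path : ∀ {x y} (w : Walk G x y) → Σ (Walk G x y) λ p → IsPath G p × p ⊆ᵛ w
  walk⇒path [ _ ] = [ _ ] , [] ∷ [] , (λ v∈ → v∈)
  walk⇒path (step {x = x} e w) with walk⇒path w
  ... | p , path , p⊆w with Any.any? (x ≟_) (vertices G p)
  ...   | yes x∈p = let s , s⊆p , spath = suffix p x∈p in s , spath path , there ∘ p⊆w ∘ s⊆p
  ...   | no  x∉p = step e p , ¬Any⇒All¬ _ x∉p ∷ path , λ { (here refl) → here refl
                                                      ; (there v∈) → there (p⊆w v∈) }

  connected⇒¬separates : ∀ {x y Z} → Connected x y Z → ¬ Separates G x y Z
  connected⇒¬separates (w , avoids) separates =
    let p , path , p⊆w = walk⇒path w
        v , v∈p , v∈Z = find (separates p path)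
    in All.lookup avoids (p⊆w v∈p) v∈Z

  ¬connected⇒separates : ∀ {x y Z} → ¬ Connected x y Z → Separates G x y Z
  ¬connected⇒separates {Z = Z} ¬conn w _ with Any.any? (λ v → Any.any? (v ≟_) Z) (vertices G w)
  ... | yes hit = hit
  ... | no miss = ⊥-elim (¬conn (w , ¬Any⇒All¬ _ miss))

  module _ (y : V) (Z : List V) where
    ConnectedWithin : ℕ → V → Set
    ConnectedWithin N x = Σ (Walk G x y) λ w → length (vertices G w) ≤ N × Avoids Z w

    connectedWithin? : ∀ N x → Dec (ConnectedWithin N x)
    connectedWithin? zero x = no λ { ([ _ ] , () , _) ; (step _ _ , () , _) }
    connectedWithin? (suc N) x with Any.any? (x ≟_) Z
    ... | yes x∈Z = no λ (w , _ , avoids) → start-avoids w avoids x∈Z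
    ... | no x∉Z with x ≟ y
    ...   | yes refl = yes ([ x ] , s≤s z≤n , x∉Z ∷ [])
    ...   | no x≢y with Any.any? (λ u → T? (E x u) ×-dec connectedWithin? N u) enum
    ...     | yes found = let _ , _ , e , w , len , a = find found in yes (step e w , s≤s len , x∉Z ∷ a)
    ...     | no none = no λ { ([ _ ] , _ , _) → x≢y refl
                            ; (step e w , s≤s len , _ ∷ a) → none (lose (complete _) (e , w , len , a)) }

  -- A connecting path has no more vertices than enum, so a bounded search is complete.
  connected? : ∀ x y Z → Dec (Connected x y Z)
  connected? x y Z with connectedWithin? y Z (length enum) x
  ... | yes (w , _ , a) = yes (w , a)
  ... | no ¬within = no λ (w , a) →
    let p , path , p⊆w = walk⇒path w
    in ¬within (p , unique-length≤ path (λ _ → complete _) , All.tabulate (All.lookup a ∘ p⊆w))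

  separates? : ∀ x y Z → Dec (Separates G x y Z)
  separates? x y Z with connected? x y Z
  ... | yes conn = no (connected⇒¬separates conn)
  ... | no ¬conn = yes (¬connected⇒separates ¬conn)

  ¬separates⇒connected : ∀ {x y Z} → ¬ Separates G x y Z → Connected x y Z
  ¬separates⇒connected {x} {y} {Z} ¬sep with connected? x y Z
  ... | yes conn = conn
  ... | no ¬conn = ⊥-elim (¬sep (¬connected⇒separates ¬conn))

module _ {k k′ : ℕ} {G : Graph k} {H : Graph k′} (f : Graph.V G → Graph.V H)
         (f-edge : ∀ {a b} → T (Graph.E G a b) → T (Graph.E H (f a) (f b))) where
  open Connectivity using (Connected)

  map-walk : ∀ {x y} → Walk G x y → Walk H (f x) (f y)
  map-walk [ x ]      = [ f x ]
  map-walk (step e w) = step (f-edge e) (map-walk w)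

  map-connected : ∀ {x y Z Z′} → (∀ {a} → a ∉ Z → f a ∉ Z′) →
                  Connected G x y Z → Connected H (f x) (f y) Z′
  map-connected f∉ (w , avoids) = map-walk w , go w avoids
    where
    go : ∀ {x y} (w : Walk G x y) → Connectivity.Avoids G _ w → Connectivity.Avoids H _ (map-walk w)
    go [ _ ]      (a∉ ∷ [])     = f∉ a∉ ∷ []
    go (step _ w) (a∉ ∷ avoids) = f∉ a∉ ∷ go w avoids

module _ {k : ℕ} (G : Graph k) where
  open Graph G

  sat? : ∀ {n} (ρ : Fin n → V) φ → Dec (Sat G ρ φ)
  sat? ρ (eq' i j)     = ρ i ≟ ρ j
  sat? ρ (edge' i j)   = T? (E (ρ i) (ρ j))
  sat? ρ (sep' i j zs) = Connectivity.separates? G (ρ i) (ρ j) _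
  sat? ρ (¬' φ)        = ¬? (sat? ρ φ)
  sat? ρ (φ ∧' ψ)      = sat? ρ φ ×-dec sat? ρ ψ
  sat? ρ (∃' φ) with Any.any? (λ v → sat? (v ▹ ρ) φ) enum
  ... | yes found = let v , _ , s = find found in yes (v , s)
  ... | no none   = no λ (v , s) → none (lose (complete v) s)

  sat-cong : ∀ {n} {ρ ρ′ : Fin n → V} → (∀ i → ρ i ≡ ρ′ i) → ∀ φ → Sat G ρ φ → Sat G ρ′ φ
  sat-cong ρ≗ρ′ (eq' i j)     s = trans (sym (ρ≗ρ′ i)) (trans s (ρ≗ρ′ j))
  sat-cong ρ≗ρ′ (edge' i j)   s = subst₂ (λ x y → T (E x y)) (ρ≗ρ′ i) (ρ≗ρ′ j) s
  sat-cong {ρ′ = ρ′} ρ≗ρ′ (sep' i j zs) s =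
    subst₂ (λ x y → Separates G x y (toList (Vec.map ρ′ zs))) (ρ≗ρ′ i) (ρ≗ρ′ j)
      (subst (Separates G _ _) (cong toList (map-cong ρ≗ρ′ zs)) s)
  sat-cong ρ≗ρ′ (¬' φ)        s = λ s′ → s (sat-cong (sym ∘ ρ≗ρ′) φ s′)
  sat-cong ρ≗ρ′ (φ ∧' ψ)      (s , t) = sat-cong ρ≗ρ′ φ s , sat-cong ρ≗ρ′ ψ t
  sat-cong ρ≗ρ′ (∃' φ)        (v , s) = v , sat-cong (λ { Fin.zero → refl ; (Fin.suc i) → ρ≗ρ′ i }) φ s

Equivalent : ∀ {k k′ n} (G : Graph k) (H : Graph k′) → ℕ →
             (Fin n → Graph.V G) → (Fin n → Graph.V H) → Set
Equivalent G H r ρ σ = ∀ φ → qr φ ≤ r → Sat G ρ φ ⇔ Sat H σ φ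

¬¬-All : ∀ {A : Set} {P : A → Set} → (∀ x → ¬ ¬ P x) → ∀ xs → ¬ ¬ All P xs
¬¬-All ¬¬p []       ¬all = ¬all []
¬¬-All ¬¬p (x ∷ xs) ¬all = ¬¬p x λ px → ¬¬-All ¬¬p xs λ pxs → ¬all (px ∷ pxs)

module _ {k k′ : ℕ} {G : Graph k} {H : Graph k′} where
  private
    module G = Graph G
    module H = Graph H

  Equivalent-sym : ∀ {n r} {ρ : Fin n → G.V} {σ} → Equivalent G H r ρ σ → Equivalent H G r σ ρ
  Equivalent-sym ρ≡σ φ q = mk⇔ (from (ρ≡σ φ q)) (to (ρ≡σ φ q))

  Equivalent-mono : ∀ {n r r′} {ρ : Fin n → G.V} {σ} → r′ ≤ r →
                    Equivalent G H r ρ σ → Equivalent G H r′ ρ σ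
  Equivalent-mono r′≤r ρ≡σ φ q = ρ≡σ φ (≤-trans q r′≤r)

  connected-transfer : ∀ {n r} {ρ : Fin n → G.V} {σ : Fin n → H.V} → Equivalent G H r ρ σ →
                       ∀ u v zs → Connectivity.Connected G (ρ u) (ρ v) (map ρ zs) →
                       Connectivity.Connected H (σ u) (σ v) (map σ zs)
  connected-transfer {ρ = ρ} {σ} ρ≡σ u v zs conn =
    Connectivity.¬separates⇒connected H λ sepH →
      Connectivity.connected⇒¬separates G conn
        (subst (Separates G _ _) (toList-map∘fromList ρ zs)
          (from (ρ≡σ (sep' u v (fromList zs)) z≤n)
            (subst (Separates H _ _) (sym (toList-map∘fromList σ zs)) sepH)))

  -- If no b worked, every b would be refuted by a rank-r formula true of a; the
  -- existential closure of the conjunction of these finitely many formulas has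
  -- rank r + 1, holds in G and fails in H.
  forth : ∀ {n r} {ρ : Fin n → G.V} {σ : Fin n → H.V} → Equivalent G H (suc r) ρ σ →
          (a : G.V) → ¬ ¬ (∃[ b ] Equivalent G H r (a ▹ ρ) (b ▹ σ))
  forth {n} {r} {ρ} {σ} ρ≡σ a ¬back = ¬¬-All refutable H.enum λ refutations →
    let b , t = to (ρ≡σ (∃' ⋀ refutations) (s≤s (⋀-qr refutations))) (a , ⋀-sat refutations)
    in ⋀-unsat refutations (H.complete b) t
    where
    Refutes : H.V → Set
    Refutes b = Σ (Formula (suc n)) λ φ → qr φ ≤ r × Sat G (a ▹ ρ) φ × ¬ Sat H (b ▹ σ) φ

    refutable : ∀ b → ¬ ¬ Refutes b
    refutable b ¬refutes = ¬back (b , λ φ q → mk⇔ (forward φ q) (backward φ q))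
      where
      forward : ∀ φ → qr φ ≤ r → Sat G (a ▹ ρ) φ → Sat H (b ▹ σ) φ
      forward φ q s = decidable-stable (sat? H _ φ) λ ¬t → ¬refutes (φ , q , s , ¬t)
      backward : ∀ φ → qr φ ≤ r → Sat H (b ▹ σ) φ → Sat G (a ▹ ρ) φ
      backward φ q t = decidable-stable (sat? G _ φ) λ ¬s → ¬refutes (¬' φ , q , ¬s , λ ¬t → ¬t t)

    ⋀ : ∀ {bs} → All Refutes bs → Formula (suc n)
    ⋀ []                = eq' Fin.zero Fin.zero
    ⋀ ((φ , _) ∷ φs) = φ ∧' ⋀ φs

    ⋀-qr : ∀ {bs} (φs : All Refutes bs) → qr (⋀ φs) ≤ r
    ⋀-qr []                = z≤n
    ⋀-qr ((_ , q , _) ∷ φs) = ⊔-lub q (⋀-qr φs)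

    ⋀-sat : ∀ {bs} (φs : All Refutes bs) → Sat G (a ▹ ρ) (⋀ φs)
    ⋀-sat []                    = refl
    ⋀-sat ((_ , _ , s , _) ∷ φs) = s , ⋀-sat φs

    ⋀-unsat : ∀ {bs b} (φs : All Refutes bs) → b ∈ bs → ¬ Sat H (b ▹ σ) (⋀ φs)
    ⋀-unsat ((_ , _ , _ , ¬t) ∷ _)  (here refl) (t , _) = ¬t t
    ⋀-unsat (_ ∷ φs)               (there b∈)  (_ , t) = ⋀-unsat φs b∈ t

-- The fusion seen from its two sides

data Side : Set where
  left right : Side

_≟ˢ_ : DecidableEquality Side
left  ≟ˢ left  = yes refl
right ≟ˢ right = yes refl
left  ≟ˢ right = no λ ()
right ≟ˢ left  = no λ ()

module Sides {k : ℕ} (G : Side → Graph k) where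
  open Fusion (G left) (G right) public using (W; EW; portW)
  open Fusion (G left) (G right) hiding (W; EW; portW)

  V : Side → Set
  V s = Graph.V (G s)

  portOf : (s : Side) → Fin k → V s
  portOf s = Graph.port (G s)

  IsPort : (s : Side) → V s → Set
  IsPort s c = ∃ λ l → portOf s l ≡ c

  F : Graph k
  F = G left ⊕ G right

  embed : (s : Side) → V s → W
  embed left  = inj₁
  embed right = ι₂

  restrict : (s : Side) → W → Maybe (V s)
  restrict left  = back₁
  restrict right = back₂

  private
    ι₂-port : ∀ l → ι₂ (B.port l) ≡ portW l
    ι₂-port l with isPort₂? (B.port l)
    ... | yes (i , e) = cong (inj₁ ∘ A.port) (B.port-inj e)
    ... | no ¬port    = ⊥-elim (¬port (l , refl))

    back₂-port : ∀ l → back₂ (portW l) ≡ just (B.port l)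
    back₂-port l with isPort₁? (A.port l)
    ... | yes (i , e) = cong (just ∘ B.port) (A.port-inj e)
    ... | no ¬port    = ⊥-elim (¬port (l , refl))

    nonPort⇒¬IsPort : ∀ c → NonPort c → ¬ IsPort right c
    nonPort⇒¬IsPort c (irr f) port = go (isPort₂? c) f
      where
      go : (d : Dec (IsPort right c)) → .(False d) → ⊥
      go (yes _)    f = ⊥-elim-irr f
      go (no ¬port) _ = ¬port port

  restrict-port : ∀ s l → restrict s (portW l) ≡ just (portOf s l)
  restrict-port left  l = refl
  restrict-port right l = back₂-port l

  restrict-embed : ∀ s c → restrict s (embed s c) ≡ just c
  restrict-embed left  c = refl
  restrict-embed right c with isPort₂? c
  ... | yes (i , e) = trans (back₂-port i) (cong just e)
  ... | no _        = refl

  restrict⇒embed : ∀ s x {c} → restrict s x ≡ just c → x ≡ embed s c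
  restrict⇒embed left  (inj₁ a)       refl = refl
  restrict⇒embed right (inj₁ a)       e    with isPort₁? a
  restrict⇒embed right (inj₁ _)       refl | yes (i , refl) = sym (ι₂-port i)
  restrict⇒embed right (inj₁ a)       ()   | no _
  restrict⇒embed right (inj₂ (c , t)) refl = sym (ι₂-hit c t)

  restrict-total : ∀ x → Σ Side λ s → ∃ λ c → restrict s x ≡ just c
  restrict-total (inj₁ a)       = left  , a , refl
  restrict-total (inj₂ (c , _)) = right , c , refl

  restrict-nonPort : ∀ {s s′ c} → s ≢ s′ → ¬ IsPort s′ c → restrict s (embed s′ c) ≡ nothing
  restrict-nonPort {left}  {left}  s≢s′ _ = ⊥-elim (s≢s′ refl)
  restrict-nonPort {right} {right} s≢s′ _ = ⊥-elim (s≢s′ refl)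
  restrict-nonPort {left}  {right} {c} _ ¬port with isPort₂? c
  ... | yes port = ⊥-elim (¬port port)
  ... | no _     = refl
  restrict-nonPort {right} {left}  {c} _ ¬port with isPort₁? c
  ... | yes port = ⊥-elim (¬port port)
  ... | no _     = refl

  restrict-cross : ∀ {s s′ x a c} → s ≢ s′ → restrict s x ≡ just a → restrict s′ x ≡ just c →
                   ∃ λ l → x ≡ portW l
  restrict-cross {left}  {left}  s≢s′ _ _ = ⊥-elim (s≢s′ refl)
  restrict-cross {right} {right} s≢s′ _ _ = ⊥-elim (s≢s′ refl)
  restrict-cross {left}  {right} _ e e′ = shared _ e e′
    where
    shared : ∀ x {a c} → back₁ x ≡ just a → back₂ x ≡ just c → ∃ λ l → x ≡ portW l
    shared (inj₁ a) refl _ with isPort₁? a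
    shared (inj₁ _) refl _  | yes (l , refl) = l , refl
    shared (inj₁ _) refl () | no _
  restrict-cross {right} {left} {x} s≢s′ e e′ = restrict-cross {left} {right} {x} (λ ()) e′ e

  data Located : W → Set where
    atPort : ∀ l → Located (portW l)
    inside : ∀ s c → ¬ IsPort s c → Located (embed s c)

  locate : ∀ x → Located x
  locate (inj₁ a) with isPort₁? a
  ... | yes (l , refl) = atPort l
  ... | no ¬port       = inside left a ¬port
  locate (inj₂ (c , t)) = subst Located (ι₂-hit c t) (inside right c (nonPort⇒¬IsPort c t))

  OnSomeSide : ((s : Side) → V s → V s → Set) → W → W → Set
  OnSomeSide R x y = Σ Side λ s → Σ (V s) λ a → Σ (V s) λ b →
                     restrict s x ≡ just a × restrict s y ≡ just b × R s a b

  ≡⇒onSomeSide : ∀ {x y} → x ≡ y → OnSomeSide (λ _ → _≡_) x y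
  ≡⇒onSomeSide {x} refl = let s , a , e = restrict-total x in s , a , a , e , e , refl

  onSomeSide⇒≡ : ∀ {x y} → OnSomeSide (λ _ → _≡_) x y → x ≡ y
  onSomeSide⇒≡ {x} {y} (s , a , _ , ex , ey , refl) =
    trans (restrict⇒embed s x ex) (sym (restrict⇒embed s y ey))

  Adjacent : (s : Side) → V s → V s → Set
  Adjacent s a b = T (Graph.E (G s) a b)

  private
    both⇒ : ∀ {X : Set} {f : X → X → Bool} mx my → T (both f mx my) →
            Σ X λ c → Σ X λ d → mx ≡ just c × my ≡ just d × T (f c d)
    both⇒ (just c) (just d) t = c , d , refl , refl , t

    ⇒both : ∀ {X : Set} {f : X → X → Bool} {mx my c d} →
            mx ≡ just c → my ≡ just d → T (f c d) → T (both f mx my)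
    ⇒both refl refl t = t

  edge⇒onSomeSide : ∀ {x y} → T (EW x y) → OnSomeSide Adjacent x y
  edge⇒onSomeSide {x} {y} t with to T-∨ t
  ... | inj₁ t₁ = left  , both⇒ (back₁ x) (back₁ y) t₁
  ... | inj₂ t₂ = right , both⇒ (back₂ x) (back₂ y) t₂

  onSomeSide⇒edge : ∀ {x y} → OnSomeSide Adjacent x y → T (EW x y)
  onSomeSide⇒edge (left  , _ , _ , ex , ey , t) = from T-∨ (inj₁ (⇒both ex ey t))
  onSomeSide⇒edge (right , _ , _ , ex , ey , t) = from T-∨ (inj₂ (⇒both ex ey t))

  embed-edge : ∀ s {c d} → Adjacent s c d → T (EW (embed s c) (embed s d))
  embed-edge s t = onSomeSide⇒edge (s , _ , _ , restrict-embed s _ , restrict-embed s _ , t)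

  side : (s : Side) → List W → List (V s)
  side s = mapMaybe (restrict s)

  module Routes (Z : List W) where
    open Connectivity using (Connected; connected-trans)
    open Connectivity F using (Avoids; start-avoids)

    Link : W → W → Set
    Link = OnSomeSide λ s a b → Connected (G s) a b (side s Z)

    data Route : W → W → Set where
      last : ∀ {x y} → Link x y → Route x y
      via  : ∀ {x y} l → Link x (portW l) → Route (portW l) y → Route x y

    ∉-restrict : ∀ s {x a} → x ∉ Z → restrict s x ≡ just a → a ∉ side s Z
    ∉-restrict s {x} x∉Z e a∈ =
      let z , z∈Z , e′ = ∈-mapMaybe⁻ (restrict s) Z a∈
      in x∉Z (subst (_∈ Z) (trans (restrict⇒embed s z e′) (sym (restrict⇒embed s x e))) z∈Z)

    ∉-embed : ∀ s {a} → a ∉ side s Z → embed s a ∉ Z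
    ∉-embed s a∉ a∈ = a∉ (∈-mapMaybe⁺ (restrict s) a∈ (restrict-embed s _))

    link-sound : ∀ {x y} → Link x y → Connected F x y Z
    link-sound (s , a , b , ex , ey , conn) =
      subst₂ (λ x y → Connected F x y Z) (sym (restrict⇒embed s _ ex)) (sym (restrict⇒embed s _ ey))
        (map-connected (embed s) (embed-edge s) (∉-embed s) conn)

    route-sound : ∀ {x y} → Route x y → Connected F x y Z
    route-sound (last ℓ)    = link-sound ℓ
    route-sound (via _ ℓ r) = connected-trans F (link-sound ℓ) (route-sound r)

    stay : ∀ {x} → x ∉ Z → Link x x
    stay {x} x∉Z = let s , a , e = restrict-total x in
      s , a , a , e , e , [ a ] , ∉-restrict s x∉Z e ∷ []

    edge-link : ∀ {x y} → T (EW x y) → x ∉ Z → y ∉ Z → Link x y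
    edge-link {x} {y} t x∉Z y∉Z =
      let s , c , d , ex , ey , e = edge⇒onSomeSide {x} {y} t in
      s , c , d , ex , ey , step e [ d ] , ∉-restrict s x∉Z ex ∷ ∉-restrict s y∉Z ey ∷ []

    -- Two links meeting at y continue each other when they lie on the same side;
    -- otherwise y lies on both sides, i.e. it is a port.
    junction : ∀ {x y z} → Link x y → Link y z → Link x z ⊎ ∃ λ l → y ≡ portW l
    junction (s , a , b , ex , ey , c₁) (s′ , b′ , d , ey′ , ez , c₂) with s ≟ˢ s′
    ... | no s≢s′ = inj₂ (restrict-cross s≢s′ ey ey′)
    ... | yes refl = inj₁ (s , a , d , ex , ez , connected-trans (G s) c₁
                             (subst (λ b → Connected (G s) b d _) (just-injective (trans (sym ey′) ey)) c₂))

    route-cons : ∀ {x y z} → Link x y → Route y z → Route x z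
    route-cons ℓ (last ℓ′) with junction ℓ ℓ′
    ... | inj₁ ℓ″        = last ℓ″
    ... | inj₂ (l , refl) = via l ℓ (last ℓ′)
    route-cons ℓ (via l′ ℓ′ r) with junction ℓ ℓ′
    ... | inj₁ ℓ″        = via l′ ℓ″ r
    ... | inj₂ (l , refl) = via l ℓ (via l′ ℓ′ r)

    route-complete : ∀ {x y} → Connected F x y Z → Route x y
    route-complete ([ _ ] , x∉Z ∷ [])     = last (stay x∉Z)
    route-complete (step t w , x∉Z ∷ avoids) =
      route-cons (edge-link t x∉Z (start-avoids w avoids)) (route-complete (w , avoids))

-- Anchored configurations

record Frame (k : ℕ) : Set where
  field
    size      : Side → ℕ
    portIndex : (s : Side) → Fin k → Fin (size s)

open Frame

-- Ports get their own places because they lie on both sides of the fusion.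
data Place {k : ℕ} (fr : Frame k) : Set where
  port   : Fin k → Place fr
  anchor : (s : Side) → Fin (size fr s) → Place fr

module _ {k : ℕ} {fr : Frame k} where
  index : (s : Side) → Place fr → Maybe (Fin (size fr s))
  index s     (port l)         = just (portIndex fr s l)
  index left  (anchor left j)  = just j
  index right (anchor right j) = just j
  index left  (anchor right _) = nothing
  index right (anchor left _)  = nothing

grow : ∀ {k} → Side → Frame k → Frame k
grow left fr = record
  { size      = λ { left → suc (size fr left) ; right → size fr right }
  ; portIndex = λ { left → Fin.suc ∘ portIndex fr left ; right → portIndex fr right } }
grow right fr = record
  { size      = λ { left → size fr left ; right → suc (size fr right) }
  ; portIndex = λ { left → portIndex fr left ; right → Fin.suc ∘ portIndex fr right } }

module _ {k : ℕ} {fr : Frame k} where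
  fresh : ∀ s → Place (grow s fr)
  fresh left  = anchor left Fin.zero
  fresh right = anchor right Fin.zero

  shift : ∀ s → Place fr → Place (grow s fr)
  shift _     (port l)         = port l
  shift left  (anchor left j)  = anchor left (Fin.suc j)
  shift left  (anchor right j) = anchor right j
  shift right (anchor left j)  = anchor left j
  shift right (anchor right j) = anchor right (Fin.suc j)

record Anchors {k : ℕ} (G : Side → Graph k) (fr : Frame k) : Set where
  open Sides G using (V; portOf)
  field
    β      : (s : Side) → Fin (size fr s) → V s
    β-port : ∀ s l → β s (portIndex fr s l) ≡ portOf s l

open Anchors

extend : ∀ {k} {G : Side → Graph k} {fr} s → Sides.V G s → Anchors G fr → Anchors G (grow s fr)
extend left a α = record
  { β      = λ { left → a ▹ β α left ; right → β α right }
  ; β-port = λ { left → β-port α left ; right → β-port α right } }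
extend right a α = record
  { β      = λ { left → β α left ; right → a ▹ β α right }
  ; β-port = λ { left → β-port α left ; right → β-port α right } }

module Anchored {k : ℕ} {G : Side → Graph k} {fr : Frame k} (α : Anchors G fr) where
  open Sides G

  val : Place fr → W
  val (port l)     = portW l
  val (anchor s j) = embed s (β α s j)

  Good : Place fr → Set
  Good (port _)     = ⊤
  Good (anchor s j) = ¬ IsPort s (β α s j)

  restrict-val : ∀ s κ → Good κ → restrict s (val κ) ≡ Maybe.map (β α s) (index s κ)
  restrict-val s     (port l)         _    = trans (restrict-port s l) (cong just (sym (β-port α s l)))
  restrict-val left  (anchor left _)  _    = restrict-embed left _
  restrict-val right (anchor right _) _    = restrict-embed right _
  restrict-val left  (anchor right _) good = restrict-nonPort (λ ()) good
  restrict-val right (anchor left _)  good = restrict-nonPort (λ ()) good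

  side-val : ∀ s {κs} → All Good κs → side s (map val κs) ≡ map (β α s) (mapMaybe (index s) κs)
  side-val s goods = mapMaybe-map (All.map (λ {κ} → restrict-val s κ) goods)

module _ {k : ℕ} {G : Side → Graph k} {fr : Frame k} (α : Anchors G fr) where
  open Anchored

  val-fresh : ∀ s a → val (extend s a α) (fresh s) ≡ Sides.embed G s a
  val-fresh left  _ = refl
  val-fresh right _ = refl

  val-shift : ∀ s a κ → val (extend s a α) (shift s κ) ≡ val α κ
  val-shift _     _ (port _)         = refl
  val-shift left  _ (anchor left _)  = refl
  val-shift left  _ (anchor right _) = refl
  val-shift right _ (anchor left _)  = refl
  val-shift right _ (anchor right _) = refl

  good-fresh : ∀ s {a} → ¬ Sides.IsPort G s a → Good (extend s a α) (fresh s)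
  good-fresh left  ¬port = ¬port
  good-fresh right ¬port = ¬port

  good-shift : ∀ s a κ → Good α κ → Good (extend s a α) (shift s κ)
  good-shift _     _ (port _)         g = g
  good-shift left  _ (anchor left _)  g = g
  good-shift left  _ (anchor right _) g = g
  good-shift right _ (anchor left _)  g = g
  good-shift right _ (anchor right _) g = g

  extend-equiv : ∀ {G′ : Side → Graph k} {α′ : Anchors G′ fr} {r} s {a b} →
                 Equivalent (G s) (G′ s) r (a ▹ β α s) (b ▹ β α′ s) →
                 (∀ s → Equivalent (G s) (G′ s) (suc r) (β α s) (β α′ s)) →
                 ∀ s′ → Equivalent (G s′) (G′ s′) r (β (extend s a α) s′) (β (extend s b α′) s′)
  extend-equiv left  new _   left  = new
  extend-equiv left  _   old right = Equivalent-mono (n≤1+n _) (old right)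
  extend-equiv right _   old left  = Equivalent-mono (n≤1+n _) (old left)
  extend-equiv right new _   right = new

  fresh-nonPort : ∀ {G′ : Side → Graph k} {α′ : Anchors G′ fr} {r} s {a b} →
                  Equivalent (G s) (G′ s) r (a ▹ β α s) (b ▹ β α′ s) →
                  ¬ Sides.IsPort G s a → ¬ Sides.IsPort G′ s b
  fresh-nonPort {α′ = α′} s a≡b ¬port (l , port≡b) =
    ¬port (l , sym (trans (from (a≡b (eq' Fin.zero (Fin.suc (portIndex fr s l))) z≤n)
                                (trans (sym port≡b) (sym (β-port α′ s l))))
                          (β-port α s l)))

record Config {k : ℕ} (G H : Side → Graph k) (r n : ℕ) : Set where
  field
    frame : Frame k
    α     : Anchors G frame
    α′    : Anchors H frame
    equiv : ∀ s → Equivalent (G s) (H s) r (β α s) (β α′ s)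
    place : Fin n → Place frame
    good  : ∀ i → Anchored.Good α (place i)
    good′ : ∀ i → Anchored.Good α′ (place i)

  assignment : Fin n → Sides.W G
  assignment = Anchored.val α ∘ place

  assignment′ : Fin n → Sides.W H
  assignment′ = Anchored.val α′ ∘ place

swap : ∀ {k} {G H : Side → Graph k} {r n} → Config G H r n → Config H G r n
swap c = record
  { frame = frame ; α = α′ ; α′ = α ; equiv = λ s → Equivalent-sym (equiv s)
  ; place = place ; good = good′ ; good′ = good }
  where open Config c

module Transfer {k : ℕ} {G H : Side → Graph k} {r n : ℕ} (c : Config G H r n) where
  open Config c
  private
    module SG = Sides G
    module SH = Sides H
    module AG = Anchored α
    module AH = Anchored α′

  Good₂ : Place frame → Set
  Good₂ κ = AG.Good κ × AH.Good κ

  onSomeSide-transfer :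
    ∀ {R : (s : Side) → SG.V s → SG.V s → Set} {R′ : (s : Side) → SH.V s → SH.V s → Set} →
    (∀ s u v → R s (β α s u) (β α s v) → R′ s (β α′ s u) (β α′ s v)) →
    ∀ {κ κ′} → Good₂ κ → Good₂ κ′ →
    SG.OnSomeSide R (AG.val κ) (AG.val κ′) → SH.OnSomeSide R′ (AH.val κ) (AH.val κ′)
  onSomeSide-transfer f {κ} {κ′} (g , h) (g′ , h′) (s , _ , _ , ea , eb , rel)
    with map-just⁻ (index s κ) (trans (sym (AG.restrict-val s κ g)) ea)
       | map-just⁻ (index s κ′) (trans (sym (AG.restrict-val s κ′ g′)) eb)
  ... | u , iu , refl | v , iv , refl =
    s , _ , _ , trans (AH.restrict-val s κ h) (map-just iu)
              , trans (AH.restrict-val s κ′ h′) (map-just iv) , f s u v rel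

  good₂ : ∀ i → Good₂ (place i)
  good₂ i = good i , good′ i

  ≡-transfer : ∀ i j → assignment i ≡ assignment j → assignment′ i ≡ assignment′ j
  ≡-transfer i j e = SH.onSomeSide⇒≡
    (onSomeSide-transfer (λ s u v → to (equiv s (eq' u v) z≤n)) (good₂ i) (good₂ j) (SG.≡⇒onSomeSide e))

  edge-transfer : ∀ i j → T (SG.EW (assignment i) (assignment j)) → T (SH.EW (assignment′ i) (assignment′ j))
  edge-transfer i j e = SH.onSomeSide⇒edge
    (onSomeSide-transfer (λ s u v → to (equiv s (edge' u v) z≤n)) (good₂ i) (good₂ j) (SG.edge⇒onSomeSide e))

  module _ (zs : List (Fin n)) where
    private
      κs = map place zs
      goods : All Good₂ κs
      goods = All-map⁺ (All.universal good₂ zs)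
      module RG = SG.Routes (map AG.val κs)
      module RH = SH.Routes (map AH.val κs)

    link-transfer : ∀ {κ κ′} → Good₂ κ → Good₂ κ′ →
                    RG.Link (AG.val κ) (AG.val κ′) → RH.Link (AH.val κ) (AH.val κ′)
    link-transfer = onSomeSide-transfer λ s u v conn →
      subst (Connectivity.Connected (H s) _ _) (sym (AH.side-val s (All.map proj₂ goods)))
        (connected-transfer (equiv s) u v (mapMaybe (index s) κs)
          (subst (Connectivity.Connected (G s) _ _) (AG.side-val s (All.map proj₁ goods)) conn))

    route-transfer : ∀ {κ κ′} → Good₂ κ → Good₂ κ′ →
                     RG.Route (AG.val κ) (AG.val κ′) → RH.Route (AH.val κ) (AH.val κ′)
    route-transfer g g′ (RG.last ℓ)    = RH.last (link-transfer g g′ ℓ)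
    route-transfer g g′ (RG.via l ℓ r) = RH.via l (link-transfer g (tt , tt) ℓ) (route-transfer (tt , tt) g′ r)

module _ {k : ℕ} {G H : Side → Graph k} {r n : ℕ} (c : Config G H (suc r) n) where
  open Config c

  Extends : Config G H r (suc n) → Sides.W G → Sides.W H → Set
  Extends c′ x y = (∀ i → Config.assignment c′ i ≡ (x ▹ assignment) i)
                 × (∀ i → Config.assignment′ c′ i ≡ (y ▹ assignment′) i)

  addPort : Fin k → Config G H r (suc n)
  addPort l = record
    { frame = frame ; α = α ; α′ = α′ ; equiv = λ s → Equivalent-mono (n≤1+n r) (equiv s)
    ; place = port l ▹ place
    ; good  = λ { Fin.zero → tt ; (Fin.suc i) → good i }
    ; good′ = λ { Fin.zero → tt ; (Fin.suc i) → good′ i } }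

  addAnchor : ∀ s {a b} → ¬ Sides.IsPort G s a → Equivalent (G s) (H s) r (a ▹ β α s) (b ▹ β α′ s) →
              Config G H r (suc n)
  addAnchor s {a} {b} ¬port a≡b = record
    { frame = grow s frame ; α = extend s a α ; α′ = extend s b α′
    ; equiv = extend-equiv α {α′ = α′} s a≡b equiv
    ; place = fresh s ▹ shift s ∘ place
    ; good  = λ { Fin.zero → good-fresh α s ¬port ; (Fin.suc i) → good-shift α s a (place i) (good i) }
    ; good′ = λ { Fin.zero → good-fresh α′ s (fresh-nonPort α {α′ = α′} s a≡b ¬port)
                ; (Fin.suc i) → good-shift α′ s b (place i) (good′ i) } }

  addPort-extends : ∀ l → Extends (addPort l) (Sides.portW G l) (Sides.portW H l)
  addPort-extends l = (λ { Fin.zero → refl ; (Fin.suc _) → refl })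
                    , (λ { Fin.zero → refl ; (Fin.suc _) → refl })

  addAnchor-extends : ∀ s {a b} (¬port : ¬ Sides.IsPort G s a) a≡b →
                      Extends (addAnchor s {a} {b} ¬port a≡b) (Sides.embed G s a) (Sides.embed H s b)
  addAnchor-extends s {a} {b} _ _ =
      (λ { Fin.zero → val-fresh α  s a ; (Fin.suc i) → val-shift α  s a (place i) })
    , (λ { Fin.zero → val-fresh α′ s b ; (Fin.suc i) → val-shift α′ s b (place i) })

separates-transfer : ∀ {k} {G H : Side → Graph k} {r n} (c : Config G H r n) i j {m} (zs : Vec (Fin n) m) →
                     Sat (Sides.F G) (Config.assignment c) (sep' i j zs) →
                     Sat (Sides.F H) (Config.assignment′ c) (sep' i j zs)
separates-transfer {G = G} {H} c i j zs sepG =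
  subst (Separates (Sides.F H) _ _) (sym (toList-map-assignment α′))
    (Connectivity.¬connected⇒separates (Sides.F H) λ connH →
      Connectivity.connected⇒¬separates (Sides.F G)
        (RG.route-sound (Transfer.route-transfer (swap c) (toList zs)
          (Transfer.good₂ (swap c) i) (Transfer.good₂ (swap c) j) (RH.route-complete connH)))
        (subst (Separates (Sides.F G) _ _) (toList-map-assignment α) sepG))
  where
  open Config c
  module RG = Sides.Routes G (map (Anchored.val α) (map place (toList zs)))
  module RH = Sides.Routes H (map (Anchored.val α′) (map place (toList zs)))
  toList-map-assignment : ∀ {G′ : Side → Graph _} (γ : Anchors G′ frame) →
    toList (Vec.map (Anchored.val γ ∘ place) zs) ≡ map (Anchored.val γ) (map place (toList zs))
  toList-map-assignment γ = trans (toList-map _ zs) (map-∘ (toList zs))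

transfer : ∀ {k} {G H : Side → Graph k} {r n} (c : Config G H r n) φ → qr φ ≤ r →
           Sat (Sides.F G) (Config.assignment c) φ → Sat (Sides.F H) (Config.assignment′ c) φ
transfer c (eq' i j)     _ = Transfer.≡-transfer c i j
transfer c (edge' i j)   _ = Transfer.edge-transfer c i j
transfer c (sep' i j zs) _ = separates-transfer c i j zs
transfer c (¬' φ)        q ¬s t = ¬s (transfer (swap c) φ q t)
transfer c (φ ∧' ψ)      q (s , t) = transfer c φ (m⊔n≤o⇒m≤o _ _ q) s , transfer c ψ (m⊔n≤o⇒n≤o _ _ q) t
transfer {G = G} {H} c (∃' φ) (s≤s q) (x , sat) = witness (Sides.locate G x) sat
  where
  open Config c
  continue : ∀ c′ {x y} → Extends c c′ x y → Sat (Sides.F G) (x ▹ assignment) φ →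
             Sat (Sides.F H) assignment′ (∃' φ)
  continue c′ {y = y} (e , e′) sat = y , sat-cong _ e′ φ (transfer c′ φ q (sat-cong _ (sym ∘ e) φ sat))

  witness : ∀ {x} → Sides.Located G x → Sat (Sides.F G) (x ▹ assignment) φ →
            Sat (Sides.F H) assignment′ (∃' φ)
  witness (Sides.atPort l)         = continue (addPort c l) (addPort-extends c l)
  witness (Sides.inside s a ¬port) sat =
    decidable-stable (sat? (Sides.F H) assignment′ (∃' φ)) λ ¬goal →
      forth (equiv s) a λ (b , a≡b) → ¬goal (continue (addAnchor c s ¬port a≡b) (addAnchor-extends c s ¬port a≡b) sat)

sides : ∀ {k} → Graph k → Graph k → Side → Graph k
sides G₁ G₂ left  = G₁
sides G₁ G₂ right = G₂

portsOnly : ∀ {k} {G₁ G₂ G₁′ G₂′ : Graph k} {r} → G₁ ≡[ r ] G₁′ → G₂ ≡[ r ] G₂′ →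
            Config (sides G₁ G₂) (sides G₁′ G₂′) r k
portsOnly {k} {G₁} {G₂} {G₁′} {G₂′} G₁≡G₁′ G₂≡G₂′ = record
  { frame = record { size = λ _ → k ; portIndex = λ _ l → l }
  ; α     = record { β = Sides.portOf (sides G₁ G₂) ; β-port = λ _ _ → refl }
  ; α′    = record { β = Sides.portOf (sides G₁′ G₂′) ; β-port = λ _ _ → refl }
  ; equiv = λ { left → G₁≡G₁′ ; right → G₂≡G₂′ }
  ; place = port ; good = λ _ → tt ; good′ = λ _ → tt }

mainTheorem2 : (r k : ℕ) (G₁ G₂ G₁′ G₂′ : Graph k) →
    G₁ ≡[ r ] G₁′ → G₂ ≡[ r ] G₂′ → (G₁ ⊕ G₂) ≡[ r ] (G₁′ ⊕ G₂′)
mainTheorem2 r k G₁ G₂ G₁′ G₂′ G₁≡G₁′ G₂≡G₂′ φ q =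
  mk⇔ (transfer ports φ q) (transfer (swap ports) φ q)
  where
  ports = portsOnly {G₁ = G₁} {G₂} {G₁′} {G₂′} G₁≡G₁′ G₂≡G₂′
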